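{- Let $n$ be a positive integer, let $\zeta$ be a primitive $(2n+1)$-st root of unity in $\mathbb{C}$, and for integers $i,j$ put $\alpha_{i,j} = \zeta^i+\zeta^{ -i}+\zeta^j+\zeta^{ -j}$. Then $$ \prod_{1 \le i < j \le n} \alpha_{i,j} = \begin{cases} 1 & \text{if } n \equiv 0,1,3 \pmod 4,\\ -1 & \text{if } n \equiv 2 \pmod 4.\end{cases} $$ -}

module Defs where

open import Level using (Level)
open import Data.Nat using (ℕ; zero; suc; _∸_; _<_; _%_)
open import Data.Product using (_×_)
open import Relation.Nullary using (¬_)
open import Relation.Binary.PropositionalEquality using (_≡_)
open import Algebra.Bundles using (CommutativeRing; Semiring)
open import Data.Sum using (_⊎_)
import Algebra.Definitions.RawSemiring as RS

module _ {c ℓ : Level} (R : CommutativeRing c ℓ) where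
  open CommutativeRing R
  open RS (Semiring.rawSemiring semiring) using (_^_) renaming (_×_ to _·ℕ_)

  IsIntegralDomain : Set (c Level.⊔ ℓ)
  IsIntegralDomain = (¬ (1# ≈ 0#)) × (∀ x y → x * y ≈ 0# → (x ≈ 0#) ⊎ (y ≈ 0#))

  CharZero : Set ℓ
  CharZero = ∀ k → ¬ (suc k ·ℕ 1# ≈ 0#)

  IsPrimitiveRoot : ℕ → Carrier → Set ℓ
  IsPrimitiveRoot m ζ = (ζ ^ m ≈ 1#) × (∀ k → 0 < k → k < m → ¬ (ζ ^ k ≈ 1#))

  prodTo : (ℕ → Carrier) → ℕ → Carrier
  prodTo f zero = 1#
  prodTo f (suc k) = prodTo f k * f (suc k)

  -- α_{i,j} = ζ^i + ζ^{-i} + ζ^j + ζ^{-j}, with ζinv the inverse of ζ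
  α : Carrier → Carrier → ℕ → ℕ → Carrier
  α ζ ζinv i j = ζ ^ i + ζinv ^ i + ζ ^ j + ζinv ^ j

  prodα : Carrier → Carrier → ℕ → Carrier
  prodα ζ ζinv n = prodTo (λ j → prodTo (λ i → α ζ ζinv i j) (j ∸ 1)) n

  signRHS : ℕ → Carrier
  signRHS n with n % 4
  ... | 2 = - 1#
  ... | _ = 1#

-- Let m = 2n + 1, ω = ζ^(n+1) (a square root of ζ, as ζ^m = 1), c k = ω^k + ω^-k and
-- s k = ω^k - ω^-k. Then α i j = c (j + i) c (j - i), so row j of the product times c j
-- telescopes to C (2j - 1), where C t = c 1 ⋯ c t; hence P · C n = ∏_{j ≤ n} C (2j - 1).
-- As c a = c (m - a), C a · C b = (C n)² whenever a + b = 2n, and pairing j with n + 1 - j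
-- reduces the right-hand side to (C n)^n. Finally s k c k = s (2k) and s a = - s (m - a) give
-- S · C n = (-1)^⌈n/2⌉ S for S = s 1 ⋯ s n, which is nonzero because ζ is primitive;
-- so C n = (-1)^⌈n/2⌉ and P = (C n)^(n+1).

module Submission where

open import Defs
open import Level using (Level)
open import Data.Nat using (ℕ; suc; _+_; _*_)
open import Algebra.Bundles using (CommutativeRing)

open import Data.Nat using (zero; pred; _∸_; _≤_; _<_; s≤s)
import Data.Nat.Properties as ℕ
open import Data.Nat.Tactic.RingSolver using (solve-∀)
open import Data.Product using (proj₁; proj₂)
open import Data.Sum using (inj₁; inj₂)
open import Data.Empty using (⊥-elim)
open import Data.Maybe using (nothing)
open import Function using (_∘_)
open import Relation.Nullary using (¬_)
open import Relation.Binary.PropositionalEquality as ≡ using (_≡_; cong)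
open import Tactic.RingSolver.Core.AlmostCommutativeRing using (fromCommutativeRing)
import Tactic.RingSolver.NonReflective as NonReflective
import Algebra.Properties.Ring as RingProperties
import Algebra.Properties.CommutativeSemigroup as CommutativeSemigroupProperties
import Algebra.Properties.CommutativeSemiring.Exp as ExpProperties

data Parity : ℕ → Set where
  even : ∀ h → Parity (h + h)
  odd  : ∀ h → Parity (suc (h + h))

parity : ∀ n → Parity n
parity zero = even 0
parity (suc n) with parity n
... | even h = odd h
... | odd h  = ≡.subst Parity (cong suc (ℕ.+-suc h h)) (even (suc h))

sin-reflect-index : ∀ n h k i j → n ≡ h + k → suc (i + j) ≡ k →
                    (h + suc i) + (h + suc i) + suc (j + j) ≡ suc (2 * n)
sin-reflect-index _ h _ i j ≡.refl ≡.refl = identity h i j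
  where
  identity : ∀ h i j → (h + suc i) + (h + suc i) + suc (j + j) ≡ suc (2 * (h + suc (i + j)))
  identity = solve-∀

cos-reflect-index : ∀ n a b i j → a + b ≡ n + n → suc (i + j) ≡ b → (a + suc i) + suc j ≡ suc (2 * n)
cos-reflect-index n a _ i j a+b≡2n ≡.refl = begin
  (a + suc i) + suc j     ≡⟨ identity a i j ⟩
  suc (a + suc (i + j))   ≡⟨ cong suc a+b≡2n ⟩
  suc (n + n)             ≡⟨ cong (suc ∘ (n +_)) (≡.sym (ℕ.+-identityʳ n)) ⟩
  suc (2 * n)             ∎
  where
  open ≡.≡-Reasoning
  identity : ∀ a i j → (a + suc i) + suc j ≡ suc (a + suc (i + j))
  identity = solve-∀

odd-pair-index : ∀ n i j → suc (i + j) ≡ n → suc (i + i) + suc (j + j) ≡ n + n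
odd-pair-index _ i j ≡.refl = identity i j
  where
  identity : ∀ i j → suc (i + i) + suc (j + j) ≡ suc (i + j) + suc (i + j)
  identity = solve-∀

module _ {c ℓ : Level} (R : CommutativeRing c ℓ) where
  open CommutativeRing R renaming (_+_ to infixl 6 _⊕_; _*_ to infixl 7 _⊗_)
  open RingProperties ring
  open CommutativeSemigroupProperties *-commutativeSemigroup
  open ExpProperties commutativeSemiring
  open import Relation.Binary.Reasoning.Setoid setoid

  private
    Π : (ℕ → Carrier) → ℕ → Carrier
    Π = prodTo R

  -- Powers of units

  -1*-1≈1 : - 1# ⊗ - 1# ≈ 1#
  -1*-1≈1 = trans (-1*x≈-x (- 1#)) (-‿involutive 1#)

  1^k≈1 : ∀ k → 1# ^ k ≈ 1#
  1^k≈1 zero    = refl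
  1^k≈1 (suc k) = trans (*-identityˡ _) (1^k≈1 k)

  ^-inverse : ∀ {x y} → x ⊗ y ≈ 1# → ∀ k → x ^ k ⊗ y ^ k ≈ 1#
  ^-inverse xy≈1 k = trans (sym (^-distrib-* _ _ k)) (trans (^-congˡ k xy≈1) (1^k≈1 k))

  sign-square : ∀ {x} k → x ≈ (- 1#) ^ k → x ⊗ x ≈ 1#
  sign-square k x≈±1 = trans (*-cong x≈±1 x≈±1) (^-inverse -1*-1≈1 k)

  ^-+-cancel : ∀ {x y} → x ⊗ y ≈ 1# → ∀ a b → x ^ (a + b) ⊗ y ^ b ≈ x ^ a
  ^-+-cancel {x} {y} xy≈1 a b = begin
    x ^ (a + b) ⊗ y ^ b     ≈⟨ *-congʳ (^-homo-* x a b) ⟩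
    x ^ a ⊗ x ^ b ⊗ y ^ b   ≈⟨ *-assoc _ _ _ ⟩
    x ^ a ⊗ (x ^ b ⊗ y ^ b) ≈⟨ *-congˡ (^-inverse xy≈1 b) ⟩
    x ^ a ⊗ 1#              ≈⟨ *-identityʳ _ ⟩
    x ^ a                   ∎

  ^-reflect : ∀ {x y m} → x ⊗ y ≈ 1# → x ^ m ≈ 1# → ∀ a b → a + b ≡ m → x ^ a ≈ y ^ b
  ^-reflect {x} {y} xy≈1 x^m≈1 a b ≡.refl = begin
    x ^ a               ≈⟨ ^-+-cancel xy≈1 a b ⟨
    x ^ (a + b) ⊗ y ^ b ≈⟨ *-congʳ x^m≈1 ⟩
    1# ⊗ y ^ b          ≈⟨ *-identityˡ _ ⟩
    y ^ b               ∎

  ^-inverse-root : ∀ {x y m} → x ⊗ y ≈ 1# → x ^ m ≈ 1# → y ^ m ≈ 1#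
  ^-inverse-root {x} {y} {m} xy≈1 x^m≈1 = begin
    y ^ m           ≈⟨ *-identityˡ _ ⟨
    1# ⊗ y ^ m      ≈⟨ *-congʳ x^m≈1 ⟨
    x ^ m ⊗ y ^ m   ≈⟨ ^-inverse xy≈1 m ⟩
    1#              ∎

  ^-root : ∀ {x} m → x ^ m ≈ 1# → ∀ a → (x ^ a) ^ m ≈ 1#
  ^-root {x} m x^m≈1 a = begin
    (x ^ a) ^ m ≈⟨ ^-assocʳ x a m ⟩
    x ^ (a * m) ≡⟨ cong (x ^_) (ℕ.*-comm a m) ⟩
    x ^ (m * a) ≈⟨ ^-assocʳ x m a ⟨
    (x ^ m) ^ a ≈⟨ ^-congˡ a x^m≈1 ⟩
    1# ^ a      ≈⟨ 1^k≈1 a ⟩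
    1#          ∎

  ^-half : ∀ {x} n → x ^ suc (2 * n) ≈ 1# → ∀ k → (x ^ suc n) ^ (k + k) ≈ x ^ k
  ^-half {x} n x^m≈1 k = begin
    (x ^ suc n) ^ (k + k)           ≈⟨ ^-assocʳ x (suc n) (k + k) ⟩
    x ^ (suc n * (k + k))           ≡⟨ cong (x ^_) (exponent n k) ⟩
    x ^ (k + suc (2 * n) * k)       ≈⟨ ^-homo-* x k _ ⟩
    x ^ k ⊗ x ^ (suc (2 * n) * k)   ≈⟨ *-congˡ (^-assocʳ x (suc (2 * n)) k) ⟨
    x ^ k ⊗ (x ^ suc (2 * n)) ^ k   ≈⟨ *-congˡ (trans (^-congˡ k x^m≈1) (1^k≈1 k)) ⟩
    x ^ k ⊗ 1#                      ≈⟨ *-identityʳ _ ⟩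
    x ^ k                           ∎
    where
    exponent : ∀ n k → suc n * (k + k) ≡ k + suc (2 * n) * k
    exponent = solve-∀

  -- Finite products

  prodTo-cong : ∀ {f g} K → (∀ i → i < K → f (suc i) ≈ g (suc i)) → Π f K ≈ Π g K
  prodTo-cong zero    _   = refl
  prodTo-cong (suc K) f≈g =
    *-cong (prodTo-cong K (λ i i<K → f≈g i (ℕ.m<n⇒m<1+n i<K))) (f≈g K ℕ.≤-refl)

  prodTo-split : ∀ f a b → Π f (a + b) ≈ Π f a ⊗ Π (λ i → f (a + i)) b
  prodTo-split f a zero = begin
    Π f (a + 0) ≡⟨ cong (Π f) (ℕ.+-identityʳ a) ⟩
    Π f a       ≈⟨ *-identityʳ _ ⟨
    Π f a ⊗ 1#  ∎
  prodTo-split f a (suc b) = begin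
    Π f (a + suc b)                                 ≡⟨ cong (Π f) (ℕ.+-suc a b) ⟩
    Π f (a + b) ⊗ f (suc (a + b))                   ≈⟨ *-cong (prodTo-split f a b) (reflexive (cong f (≡.sym (ℕ.+-suc a b)))) ⟩
    Π f a ⊗ Π (λ i → f (a + i)) b ⊗ f (a + suc b)   ≈⟨ *-assoc _ _ _ ⟩
    Π f a ⊗ Π (λ i → f (a + i)) (suc b)             ∎

  prodTo-suc : ∀ f K → Π f (suc K) ≈ f 1 ⊗ Π (f ∘ suc) K
  prodTo-suc f K = trans (prodTo-split f 1 K) (*-congʳ (*-identityˡ (f 1)))

  prodTo-peel : ∀ f K → Π f (suc (suc K)) ≈ f 1 ⊗ f (suc (suc K)) ⊗ Π (f ∘ suc) K
  prodTo-peel f K = trans (*-congʳ (prodTo-suc f K)) (xy∙z≈xz∙y _ _ _)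

  prodTo-distrib-⊗ : ∀ f g K → Π (λ i → f i ⊗ g i) K ≈ Π f K ⊗ Π g K
  prodTo-distrib-⊗ f g zero    = sym (*-identityˡ 1#)
  prodTo-distrib-⊗ f g (suc K) = trans (*-congʳ (prodTo-distrib-⊗ f g K)) (interchange _ _ _ _)

  prodTo-neg : ∀ f K → Π (λ i → - f i) K ≈ (- 1#) ^ K ⊗ Π f K
  prodTo-neg f zero    = sym (*-identityˡ 1#)
  prodTo-neg f (suc K) = begin
    Π (λ i → - f i) K ⊗ - f (suc K)             ≈⟨ *-cong (prodTo-neg f K) (sym (-1*x≈-x _)) ⟩
    (- 1#) ^ K ⊗ Π f K ⊗ (- 1# ⊗ f (suc K))     ≈⟨ interchange _ _ _ _ ⟩
    (- 1#) ^ K ⊗ - 1# ⊗ (Π f K ⊗ f (suc K))     ≈⟨ *-congʳ (*-comm _ _) ⟩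
    (- 1#) ^ suc K ⊗ Π f (suc K)                ∎

  prodTo-reverse : ∀ {f g} K → (∀ i j → suc (i + j) ≡ K → f (suc i) ≈ g (suc j)) → Π f K ≈ Π g K
  prodTo-reverse         zero    _   = refl
  prodTo-reverse {f} {g} (suc K) f≈g = begin
    Π f (suc K)           ≈⟨ prodTo-suc f K ⟩
    f 1 ⊗ Π (f ∘ suc) K   ≈⟨ *-cong (f≈g 0 K ≡.refl) (prodTo-reverse K λ i j eq → f≈g (suc i) j (cong suc eq)) ⟩
    g (suc K) ⊗ Π g K     ≈⟨ *-comm _ _ ⟩
    Π g (suc K)           ∎

  prodTo-reverse-⊗ : ∀ {f g h} K → (∀ i j → suc (i + j) ≡ K → f (suc i) ≈ g (suc i) ⊗ h (suc j)) →
                     Π f K ≈ Π g K ⊗ Π h K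
  prodTo-reverse-⊗             zero    _    = sym (*-identityˡ 1#)
  prodTo-reverse-⊗ {f} {g} {h} (suc K) f≈gh = begin
    Π f (suc K)                                   ≈⟨ prodTo-suc f K ⟩
    f 1 ⊗ Π (f ∘ suc) K                           ≈⟨ *-cong (f≈gh 0 K ≡.refl) inner ⟩
    g 1 ⊗ h (suc K) ⊗ (Π (g ∘ suc) K ⊗ Π h K)     ≈⟨ interchange _ _ _ _ ⟩
    g 1 ⊗ Π (g ∘ suc) K ⊗ (h (suc K) ⊗ Π h K)     ≈⟨ *-cong (prodTo-suc g K) (*-comm _ _) ⟨
    Π g (suc K) ⊗ Π h (suc K)                     ∎
    where
    inner : Π (f ∘ suc) K ≈ Π (g ∘ suc) K ⊗ Π h K
    inner = prodTo-reverse-⊗ K λ i j eq → f≈gh (suc i) j (cong suc eq)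

  prodTo-inversePairs-even : ∀ f h → (∀ i j → suc (i + j) ≡ h + h → f (suc i) ⊗ f (suc j) ≈ 1#) →
                             Π f (h + h) ≈ 1#
  prodTo-inversePairs-even f zero    _     = refl
  prodTo-inversePairs-even f (suc h) pairs = begin
    Π f (suc h + suc h)                                 ≡⟨ cong (Π f) length ⟩
    Π f (suc (suc (h + h)))                             ≈⟨ prodTo-peel f (h + h) ⟩
    f 1 ⊗ f (suc (suc (h + h))) ⊗ Π (f ∘ suc) (h + h)   ≈⟨ *-cong (pairs 0 _ (≡.sym length)) inner ⟩
    1# ⊗ 1#                                             ≈⟨ *-identityˡ 1# ⟩
    1#                                                  ∎
    where
    length : suc h + suc h ≡ suc (suc (h + h))
    length = cong suc (ℕ.+-suc h h)
    inner : Π (f ∘ suc) (h + h) ≈ 1#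
    inner = prodTo-inversePairs-even (f ∘ suc) h λ i j eq →
      pairs (suc i) (suc j) (≡.trans (cong (suc ∘ suc) (≡.trans (ℕ.+-suc i j) eq)) (≡.sym length))

  prodTo-inversePairs-odd : ∀ f h → (∀ i j → suc (i + j) ≡ suc (h + h) → f (suc i) ⊗ f (suc j) ≈ 1#) →
                            Π f (suc (h + h)) ≈ f (suc h)
  prodTo-inversePairs-odd f zero    _     = *-identityˡ (f 1)
  prodTo-inversePairs-odd f (suc h) pairs = begin
    Π f (suc (suc h + suc h))                                 ≡⟨ cong (Π f) length ⟩
    Π f (suc (suc (suc (h + h))))                             ≈⟨ prodTo-peel f (suc (h + h)) ⟩
    f 1 ⊗ f (suc (suc (suc (h + h)))) ⊗ Π (f ∘ suc) (suc (h + h))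
                                                              ≈⟨ *-cong (pairs 0 _ (≡.sym length)) inner ⟩
    1# ⊗ f (suc (suc h))                                      ≈⟨ *-identityˡ _ ⟩
    f (suc (suc h))                                           ∎
    where
    length : suc (suc h + suc h) ≡ suc (suc (suc (h + h)))
    length = cong (suc ∘ suc) (ℕ.+-suc h h)
    inner : Π (f ∘ suc) (suc (h + h)) ≈ f (suc (suc h))
    inner = prodTo-inversePairs-odd (f ∘ suc) h λ i j eq →
      pairs (suc i) (suc j) (≡.trans (cong (suc ∘ suc) (≡.trans (ℕ.+-suc i j) eq)) (≡.sym length))

  prodEven prodOdd : (ℕ → Carrier) → ℕ → Carrier
  prodEven f h = Π (λ r → f (r + r)) h
  prodOdd  f k = Π (λ r → f (r + pred r)) k

  prodTo-double : ∀ f h → Π f (h + h) ≈ prodEven f h ⊗ prodOdd f h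
  prodTo-double f zero    = sym (*-identityˡ 1#)
  prodTo-double f (suc h) = begin
    Π f (suc h + suc h)                                    ≡⟨ cong (Π f) length ⟩
    Π f (h + h) ⊗ f (suc (h + h)) ⊗ f (suc (suc (h + h)))  ≈⟨ *-congʳ (*-congʳ (prodTo-double f h)) ⟩
    E ⊗ O ⊗ f (suc (h + h)) ⊗ f (suc (suc (h + h)))        ≈⟨ *-congʳ (*-assoc E O _) ⟩
    E ⊗ (O ⊗ f (suc (h + h))) ⊗ f (suc (suc (h + h)))      ≈⟨ xy∙z≈xz∙y _ _ _ ⟩
    E ⊗ f (suc (suc (h + h))) ⊗ (O ⊗ f (suc (h + h)))      ≡⟨ cong (λ e → E ⊗ f e ⊗ (O ⊗ f (suc (h + h)))) length ⟨
    prodEven f (suc h) ⊗ prodOdd f (suc h)                 ∎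
    where
    E = prodEven f h
    O = prodOdd f h
    length : suc h + suc h ≡ suc (suc (h + h))
    length = cong suc (ℕ.+-suc h h)

  prodTo-suc-double : ∀ f h → Π f (suc (h + h)) ≈ prodEven f h ⊗ prodOdd f (suc h)
  prodTo-suc-double f h = trans (*-congʳ (prodTo-double f h)) (*-assoc _ _ _)

  module IntegralDomain (domain : IsIntegralDomain R) where

    prodTo-nonzero : ∀ f K → (∀ i → i < K → ¬ f (suc i) ≈ 0#) → ¬ Π f K ≈ 0#
    prodTo-nonzero f zero    _      Π≈0 = proj₁ domain Π≈0
    prodTo-nonzero f (suc K) f≉0 Π≈0 with proj₂ domain _ _ Π≈0
    ... | inj₁ prefix≈0 = prodTo-nonzero f K (λ i i<K → f≉0 i (ℕ.m<n⇒m<1+n i<K)) prefix≈0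
    ... | inj₂ last≈0   = f≉0 K ℕ.≤-refl last≈0

    *-cancelˡ-nonzero : ∀ {a x y} → ¬ a ≈ 0# → a ⊗ x ≈ a ⊗ y → x ≈ y
    *-cancelˡ-nonzero {a} {x} {y} a≉0 ax≈ay
      with proj₂ domain a (x - y) (trans (x[y-z]≈xy-xz a x y) (x≈y⇒x∙y⁻¹≈ε ax≈ay))
    ... | inj₁ a≈0   = ⊥-elim (a≉0 a≈0)
    ... | inj₂ x-y≈0 = x∙y⁻¹≈ε⇒x≈y x y x-y≈0

  -- Cosines and sines of a unit

  module CosSin {u u' : Carrier} (uu'≈1 : u ⊗ u' ≈ 1#) where

    cos sin : ℕ → Carrier
    cos k = u ^ k ⊕ u' ^ k
    sin k = u ^ k - u' ^ k

    private
      u'u≈1 : u' ⊗ u ≈ 1#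
      u'u≈1 = trans (*-comm u' u) uu'≈1

      open NonReflective (fromCommutativeRing R (λ _ → nothing))
        using (solve; _⊜_) renaming (_⊕_ to _:+_; _⊗_ to _:*_; ⊝_ to :-_)

      foil : ∀ x x' y y' → (x ⊕ x') ⊗ (y ⊕ y') ≈ (x ⊗ y' ⊕ x' ⊗ y) ⊕ (x ⊗ y ⊕ x' ⊗ y')
      foil = solve 4 (λ x x' y y' → ((x :+ x') :* (y :+ y'))
                                 ⊜ (((x :* y') :+ (x' :* y)) :+ ((x :* y) :+ (x' :* y')))) refl

    cos-product : ∀ a b → cos (b + a) ⊗ cos a ≈ cos b ⊕ cos (b + a + a)
    cos-product a b = trans (foil _ _ _ _)
      (+-cong (+-cong (^-+-cancel uu'≈1 b a) (^-+-cancel u'u≈1 b a))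
              (+-cong (sym (^-homo-* u (b + a) a)) (sym (^-homo-* u' (b + a) a))))

    sin-double : ∀ k → sin k ⊗ cos k ≈ sin (k + k)
    sin-double k = trans (foil _ _ _ _) (trans (+-cong cross≈0 squares) (+-identityˡ _))
      where
      cross≈0 : u ^ k ⊗ u' ^ k ⊕ - u' ^ k ⊗ u ^ k ≈ 0#
      cross≈0 = trans (+-congˡ (trans (sym (-‿distribˡ-* _ _)) (-‿cong (*-comm _ _)))) (-‿inverseʳ _)
      squares : u ^ k ⊗ u ^ k ⊕ - u' ^ k ⊗ u' ^ k ≈ sin (k + k)
      squares = +-cong (sym (^-homo-* u k k)) (trans (sym (-‿distribˡ-* _ _)) (-‿cong (sym (^-homo-* u' k k))))

    sin≈0⇒u^[k+k]≈1 : ∀ k → sin k ≈ 0# → u ^ (k + k) ≈ 1#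
    sin≈0⇒u^[k+k]≈1 k sin≈0 = begin
      u ^ (k + k)       ≈⟨ ^-homo-* u k k ⟩
      u ^ k ⊗ u ^ k     ≈⟨ *-congˡ (x∙y⁻¹≈ε⇒x≈y _ _ sin≈0) ⟩
      u ^ k ⊗ u' ^ k    ≈⟨ ^-inverse uu'≈1 k ⟩
      1#                ∎

    module Reflection {m} (u^m≈1 : u ^ m ≈ 1#) where

      private
        u'^m≈1 : u' ^ m ≈ 1#
        u'^m≈1 = ^-inverse-root {m = m} uu'≈1 u^m≈1

      cos-reflect : ∀ a b → a + b ≡ m → cos a ≈ cos b
      cos-reflect a b a+b≡m =
        trans (+-cong (^-reflect uu'≈1 u^m≈1 a b a+b≡m) (^-reflect u'u≈1 u'^m≈1 a b a+b≡m)) (+-comm _ _)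

      sin-reflect : ∀ a b → a + b ≡ m → sin a ≈ - sin b
      sin-reflect a b a+b≡m =
        trans (+-cong (^-reflect uu'≈1 u^m≈1 a b a+b≡m) (-‿cong (^-reflect u'u≈1 u'^m≈1 a b a+b≡m)))
              (sym (⁻¹-anti-homo‿- (u ^ b) (u' ^ b)))

  -- The product at a primitive (2n+1)-st root of unity

  module RootOfUnity (domain : IsIntegralDomain R) (n : ℕ) {ζ ζinv : Carrier}
                     (ζ-primitive : IsPrimitiveRoot R (suc (2 * n)) ζ) (ζζinv≈1 : ζ ⊗ ζinv ≈ 1#) where
    open IntegralDomain domain

    ζ^m≈1 : ζ ^ suc (2 * n) ≈ 1#
    ζ^m≈1 = proj₁ ζ-primitive

    ζinv^m≈1 : ζinv ^ suc (2 * n) ≈ 1#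
    ζinv^m≈1 = ^-inverse-root {m = suc (2 * n)} ζζinv≈1 ζ^m≈1

    ω ω' : Carrier
    ω  = ζ ^ suc n
    ω' = ζinv ^ suc n

    open CosSin {ω} {ω'} (^-inverse ζζinv≈1 (suc n))
    open Reflection {suc (2 * n)} (^-root (suc (2 * n)) ζ^m≈1 (suc n))

    cos-double : ∀ k → cos (k + k) ≈ ζ ^ k ⊕ ζinv ^ k
    cos-double k = +-cong (^-half n ζ^m≈1 k) (^-half n ζinv^m≈1 k)

    α≈cos⊗cos : ∀ {i d j} → i + d ≡ j → α R ζ ζinv i j ≈ cos (j + i) ⊗ cos d
    α≈cos⊗cos {i} {d} ≡.refl = begin
      α R ζ ζinv i (i + d)                              ≈⟨ +-assoc _ _ _ ⟩
      ζ ^ i ⊕ ζinv ^ i ⊕ (ζ ^ (i + d) ⊕ ζinv ^ (i + d))  ≈⟨ +-cong (cos-double i) (cos-double (i + d)) ⟨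
      cos (i + i) ⊕ cos ((i + d) + (i + d))              ≡⟨ cong (λ e → cos (i + i) ⊕ cos e) (outer i d) ⟩
      cos (i + i) ⊕ cos (i + i + d + d)                  ≈⟨ cos-product d (i + i) ⟨
      cos (i + i + d) ⊗ cos d                            ≡⟨ cong (λ e → cos e ⊗ cos d) (inner i d) ⟩
      cos (i + d + i) ⊗ cos d                            ∎
      where
      outer : ∀ i d → (i + d) + (i + d) ≡ i + i + d + d
      outer = solve-∀
      inner : ∀ i d → i + i + d ≡ i + d + i
      inner = solve-∀

    sin≉0 : ∀ r → 0 < r → r ≤ n → ¬ sin r ≈ 0#
    sin≉0 r 0<r r≤n sin≈0 =
      proj₂ ζ-primitive r 0<r (s≤s (ℕ.≤-trans r≤n (ℕ.m≤m+n n (n + 0))))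
            (trans (sym (^-half n ζ^m≈1 r)) (sin≈0⇒u^[k+k]≈1 r sin≈0))

    ∏cos ∏sin : ℕ → Carrier
    ∏cos = Π cos
    ∏sin = Π sin

    ∏cos-sign : ∀ h k → n ≡ h + k → ∏sin n ≈ prodEven sin h ⊗ prodOdd sin k → ∏cos n ≈ (- 1#) ^ k
    ∏cos-sign h k n≡h+k ∏sin-split = *-cancelˡ-nonzero ∏sin≉0 (begin
      ∏sin n ⊗ ∏cos n                          ≈⟨ prodTo-distrib-⊗ sin cos n ⟨
      Π (λ r → sin r ⊗ cos r) n                ≈⟨ prodTo-cong n (λ r _ → sin-double (suc r)) ⟩
      Π (λ r → sin (r + r)) n                  ≡⟨ cong (Π (λ r → sin (r + r))) n≡h+k ⟩
      Π (λ r → sin (r + r)) (h + k)            ≈⟨ prodTo-split _ h k ⟩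
      E ⊗ Π (λ i → sin ((h + i) + (h + i))) k  ≈⟨ *-congˡ (prodTo-reverse k reflected) ⟩
      E ⊗ Π (λ r → - sin (r + pred r)) k       ≈⟨ *-congˡ (prodTo-neg _ k) ⟩
      E ⊗ ((- 1#) ^ k ⊗ O)                     ≈⟨ x∙yz≈y∙xz _ _ _ ⟩
      (- 1#) ^ k ⊗ (E ⊗ O)                     ≈⟨ *-congˡ ∏sin-split ⟨
      (- 1#) ^ k ⊗ ∏sin n                      ≈⟨ *-comm _ _ ⟩
      ∏sin n ⊗ (- 1#) ^ k                      ∎)
      where
      E = prodEven sin h
      O = prodOdd sin k
      ∏sin≉0 : ¬ ∏sin n ≈ 0#
      ∏sin≉0 = prodTo-nonzero sin n (λ i i<n → sin≉0 (suc i) ℕ.0<1+n i<n)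
      reflected : ∀ i j → suc (i + j) ≡ k → sin ((h + suc i) + (h + suc i)) ≈ - sin (suc (j + j))
      reflected i j eq =
        sin-reflect ((h + suc i) + (h + suc i)) (suc (j + j)) (sin-reflect-index n h k i j n≡h+k eq)

    ∏cos-+ : ∀ a b → a + b ≡ n + n → ∏cos (a + b) ≈ ∏cos a ⊗ ∏cos b
    ∏cos-+ a b a+b≡2n = trans (prodTo-split cos a b) (*-congˡ (prodTo-reverse b reflected))
      where
      reflected : ∀ i j → suc (i + j) ≡ b → cos (a + suc i) ≈ cos (suc j)
      reflected i j eq = cos-reflect (a + suc i) (suc j) (cos-reflect-index n a b i j a+b≡2n eq)

    ∏cos-pair : ∀ a b → a + b ≡ n + n → ∏cos a ⊗ ∏cos b ≈ ∏cos n ⊗ ∏cos n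
    ∏cos-pair a b a+b≡2n = begin
      ∏cos a ⊗ ∏cos b ≈⟨ ∏cos-+ a b a+b≡2n ⟨
      ∏cos (a + b)    ≡⟨ cong ∏cos a+b≡2n ⟩
      ∏cos (n + n)    ≈⟨ ∏cos-+ n n ≡.refl ⟩
      ∏cos n ⊗ ∏cos n ∎

    ∏cos-odd-pair : ∀ i j → suc (i + j) ≡ n →
                    ∏cos (suc (i + i)) ⊗ ∏cos (suc (j + j)) ≈ ∏cos n ⊗ ∏cos n
    ∏cos-odd-pair i j eq = ∏cos-pair (suc (i + i)) (suc (j + j)) (odd-pair-index n i j eq)

    row⊗cos : ∀ j → Π (λ i → α R ζ ζinv i (suc j)) j ⊗ cos (suc j) ≈ ∏cos (suc (j + j))
    row⊗cos j = begin
      Π (λ i → α R ζ ζinv i (suc j)) j ⊗ cos (suc j)      ≈⟨ *-congʳ (prodTo-reverse-⊗ j factor) ⟩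
      Π (λ i → cos (suc j + i)) j ⊗ ∏cos j ⊗ cos (suc j)  ≈⟨ *-assoc _ _ _ ⟩
      Π (λ i → cos (suc j + i)) j ⊗ ∏cos (suc j)          ≈⟨ *-comm _ _ ⟩
      ∏cos (suc j) ⊗ Π (λ i → cos (suc j + i)) j          ≈⟨ prodTo-split cos (suc j) j ⟨
      ∏cos (suc (j + j))                                  ∎
      where
      factor : ∀ i k → suc (i + k) ≡ j → α R ζ ζinv (suc i) (suc j) ≈ cos (suc j + suc i) ⊗ cos (suc k)
      factor i k eq = α≈cos⊗cos (cong suc (≡.trans (ℕ.+-suc i k) eq))

    ∏∏cos : Carrier
    ∏∏cos = Π (λ j → ∏cos (j + pred j)) n

    prodα≈∏∏cos⊗∏cos : ∏cos n ⊗ ∏cos n ≈ 1# → prodα R ζ ζinv n ≈ ∏∏cos ⊗ ∏cos n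
    prodα≈∏∏cos⊗∏cos ∏cos²≈1 = begin
      P                       ≈⟨ *-identityʳ P ⟨
      P ⊗ 1#                  ≈⟨ *-congˡ ∏cos²≈1 ⟨
      P ⊗ (∏cos n ⊗ ∏cos n)   ≈⟨ *-assoc _ _ _ ⟨
      P ⊗ ∏cos n ⊗ ∏cos n     ≈⟨ *-congʳ (prodTo-distrib-⊗ _ cos n) ⟨
      Π (λ j → Π (λ i → α R ζ ζinv i j) (j ∸ 1) ⊗ cos j) n ⊗ ∏cos n
                              ≈⟨ *-congʳ (prodTo-cong n (λ j _ → row⊗cos j)) ⟩
      ∏∏cos ⊗ ∏cos n          ∎
      where
      P = prodα R ζ ζinv n

    prodα-even : ∀ {h} → n ≡ h + h → prodα R ζ ζinv n ≈ (- 1#) ^ h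
    prodα-even {h} n≡2h = begin
      prodα R ζ ζinv n ≈⟨ prodα≈∏∏cos⊗∏cos (sign-square h ∏cos≈) ⟩
      ∏∏cos ⊗ ∏cos n   ≈⟨ *-cong ∏∏cos≈1 ∏cos≈ ⟩
      1# ⊗ (- 1#) ^ h  ≈⟨ *-identityˡ _ ⟩
      (- 1#) ^ h       ∎
      where
      ∏cos≈ : ∏cos n ≈ (- 1#) ^ h
      ∏cos≈ = ∏cos-sign h h n≡2h (trans (reflexive (cong ∏sin n≡2h)) (prodTo-double sin h))
      ∏∏cos≈1 : ∏∏cos ≈ 1#
      ∏∏cos≈1 = trans (reflexive (cong (Π (λ j → ∏cos (j + pred j))) n≡2h))
        (prodTo-inversePairs-even _ h λ i j eq →
          trans (∏cos-odd-pair i j (≡.trans eq (≡.sym n≡2h))) (sign-square h ∏cos≈))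

    prodα-odd : ∀ {h} → n ≡ suc (h + h) → prodα R ζ ζinv n ≈ 1#
    prodα-odd {h} n≡2h+1 = begin
      prodα R ζ ζinv n ≈⟨ prodα≈∏∏cos⊗∏cos ∏cos²≈1 ⟩
      ∏∏cos ⊗ ∏cos n   ≈⟨ *-congʳ ∏∏cos≈∏cos ⟩
      ∏cos n ⊗ ∏cos n  ≈⟨ ∏cos²≈1 ⟩
      1#               ∎
      where
      ∏cos²≈1 : ∏cos n ⊗ ∏cos n ≈ 1#
      ∏cos²≈1 = sign-square (suc h) (∏cos-sign h (suc h) (≡.trans n≡2h+1 (≡.sym (ℕ.+-suc h h)))
        (trans (reflexive (cong ∏sin n≡2h+1)) (prodTo-suc-double sin h)))
      ∏∏cos≈∏cos : ∏∏cos ≈ ∏cos n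
      ∏∏cos≈∏cos = trans (reflexive (cong (Π (λ j → ∏cos (j + pred j))) n≡2h+1))
        (trans (prodTo-inversePairs-odd _ h λ i j eq →
                  trans (∏cos-odd-pair i j (≡.trans eq (≡.sym n≡2h+1))) ∏cos²≈1)
               (reflexive (cong ∏cos (≡.sym n≡2h+1))))

  -- The sign

  -- (4 + n) % 4 and n % 4 are definitionally equal, so signRHS has period 4 by computation.
  signRHS-double : ∀ h → signRHS R (h + h) ≈ (- 1#) ^ h
  signRHS-double zero                = refl
  signRHS-double (suc zero)          = sym (*-identityʳ (- 1#))
  signRHS-double (suc (suc h)) = begin
    signRHS R (suc (suc h) + suc (suc h)) ≡⟨ cong (signRHS R) (length h) ⟩
    signRHS R (4 + (h + h))               ≡⟨⟩
    signRHS R (h + h)                     ≈⟨ signRHS-double h ⟩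
    (- 1#) ^ h                            ≈⟨ *-identityˡ _ ⟨
    1# ⊗ (- 1#) ^ h                       ≈⟨ *-congʳ -1*-1≈1 ⟨
    - 1# ⊗ - 1# ⊗ (- 1#) ^ h              ≈⟨ *-assoc _ _ _ ⟩
    (- 1#) ^ suc (suc h)                  ∎
    where
    length : ∀ h → suc (suc h) + suc (suc h) ≡ 4 + (h + h)
    length = solve-∀

  signRHS-suc-double : ∀ h → signRHS R (suc (h + h)) ≡ 1#
  signRHS-suc-double zero          = ≡.refl
  signRHS-suc-double (suc zero)    = ≡.refl
  signRHS-suc-double (suc (suc h)) =
    ≡.trans (cong (signRHS R) (length h)) (signRHS-suc-double h)
    where
    length : ∀ h → suc (suc (suc h) + suc (suc h)) ≡ 4 + suc (h + h)
    length = solve-∀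

lemma3 : ∀ {c ℓ : Level} (R : CommutativeRing c ℓ) → IsIntegralDomain R → CharZero R →
         (n : ℕ) → (ζ ζinv : CommutativeRing.Carrier R) →
         IsPrimitiveRoot R (suc (2 * n)) ζ →
         CommutativeRing._≈_ R (CommutativeRing._*_ R ζ ζinv) (CommutativeRing.1# R) →
         1 Data.Nat.≤ n →
         CommutativeRing._≈_ R (prodα R ζ ζinv n) (signRHS R n)
lemma3 R domain _ n ζ ζinv ζ-primitive ζζinv≈1 _ with parity n
... | even h = trans (prodα-even {h} ≡.refl) (sym (signRHS-double R h))
  where
  open CommutativeRing R using (trans; sym; reflexive)
  open RootOfUnity R domain (h + h) ζ-primitive ζζinv≈1
... | odd h = trans (prodα-odd {h} ≡.refl) (reflexive (≡.sym (signRHS-suc-double R h)))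
  where
  open CommutativeRing R using (trans; sym; reflexive)
  open RootOfUnity R domain (suc (h + h)) ζ-primitive ζζinv≈1
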